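{- Let $n,m,d$ be positive integers with $d \mid n$ and $d \ge m \ge 2$. Then $P(n-i,m,d) = (n/d)^m$ for every integer $i$ with $0 \le i \le d-m$ (and $m < n-i$).
   Context: The Chebyshev distance between two integer sequences $\sigma,\pi$ of the same length is $\max_i|\sigma(i)-\pi(i)|$ over positions $i$. For positive integers $N$ and $m<N$, $P(N,m,d)$ is the maximum cardinality of a set $A$ of length-$m$ sequences of pairwise distinct symbols from $\{1,\dots,N\}$ such that any two distinct members of $A$ have Chebyshev distance at least $d$. -}

module Defs where

open import Data.Nat using (ℕ; _⊔_; ∣_-_∣; _≤_)
open import Data.Fin using (Fin; toℕ)
open import Data.Vec using (Vec; zipWith; foldr′)
open import Data.List using (List; length)
open import Data.List.Relation.Unary.All using (All)
open import Data.List.Relation.Unary.Unique.Propositional using (Unique)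
open import Data.List.Relation.Unary.AllPairs using (AllPairs)
open import Data.Product using (Σ; _×_)
open import Function.Definitions using (Injective)
open import Relation.Binary.PropositionalEquality using (_≡_)
open import Data.Vec using (lookup)

-- Symbols {1,…,N} are represented by Fin N (i.e. {0,…,N-1}); Chebyshev
-- distance is translation invariant, so this shift is harmless.
-- A length-m sequence of symbols from {1..N}.
Seq : ℕ → ℕ → Set
Seq N m = Vec (Fin N) m

DistinctSymbols : ∀ {N m} → Seq N m → Set
DistinctSymbols {N} {m} σ = Injective _≡_ _≡_ (lookup σ)

cheb : ∀ {N m} → Seq N m → Seq N m → ℕ
cheb σ π = foldr′ _⊔_ 0 (zipWith (λ a b → ∣ toℕ a - toℕ b ∣) σ π)

-- A (finite set, given as a duplicate-free list) is an admissible code: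
-- members have pairwise distinct symbols and distinct members have
-- Chebyshev distance at least d.
IsCode : (N m d : ℕ) → List (Seq N m) → Set
IsCode N m d A =
  Unique A × All DistinctSymbols A × AllPairs (λ σ π → d ≤ cheb σ π) A

IsP : (N m d k : ℕ) → Set
IsP N m d k =
  Σ (List (Seq N m)) (λ A → IsCode N m d A × length A ≡ k)
  × (∀ (A : List (Seq N m)) → IsCode N m d A → length A ≤ k)

{-# OPTIONS --safe #-}
module Submission where

-- Cut {0,…,N-1} into q blocks of d consecutive symbols.  Two sequences whose
-- entries lie, position by position, in the same blocks are at distance < d,
-- so a code has at most q^m members: pigeonhole on the block signatures in
-- Fin (q ^ m).  Conversely the words  j ↦ j + f(j)·d  for f : Fin m → Fin q
-- have distinct symbols (their residues mod d are the positions, as m ≤ d),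
-- are pairwise at distance ≥ d, and fit below N once (q-1)·d + m ≤ N.
-- With n = q·d and N = n - i, i ≤ d - m, both conditions hold.

open import Defs
open import Data.Nat using (ℕ; _≤_; _<_; _∸_; _^_; _/_; NonZero)
open import Data.Nat.Divisibility using (_∣_)

open import Data.Nat using (zero; suc; s<s; _+_; _*_; _⊔_; ∣_-_∣; _%_; _≤?_; >-nonZero⁻¹)
open import Data.Nat.Properties hiding (_≟_)
open import Data.Nat.DivMod
  using (m≡m%n+[m/n]*n; m%n<n; [m+kn]%n≡m%n; m<n⇒m%n≡m; m<n*o⇒m/o<n; m/n*n≡m)
open import Data.Nat.Divisibility using (∣⇒≤)
open import Data.Fin as Fin using (Fin; toℕ; fromℕ<; combine; funToFin; finToFun)
open import Data.Fin.Properties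
  using (toℕ<n; toℕ-fromℕ<; toℕ-injective; pigeonhole; ¬∀⟶∃¬;
         funToFin-finToFin; finToFun-funToFin; _≟_)
open import Data.Vec as Vec using (_∷_; lookup; tabulate)
open import Data.Vec.Properties using (lookup∘tabulate)
open import Data.List as List using (List; length)
open import Data.List.Properties using (length-tabulate)
open import Data.List.Membership.Propositional.Properties using (∈-lookup)
import Data.List.Relation.Unary.All as All
import Data.List.Relation.Unary.All.Properties as All
open import Data.List.Relation.Unary.AllPairs as AllPairs using (AllPairs; _∷_)
import Data.List.Relation.Unary.AllPairs.Properties as AllPairs
open import Data.List.Relation.Unary.Unique.Propositional using (Unique)
open import Data.Product using (∃; _,_)
open import Function using (_∘_)
open import Relation.Nullary using (yes; no; contradiction)
open import Relation.Binary.PropositionalEquality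

private
  variable
    N m d q : ℕ

∣lookup-lookup∣≤cheb : (σ π : Seq N m) (j : Fin m) →
  ∣ toℕ (lookup σ j) - toℕ (lookup π j) ∣ ≤ cheb σ π
∣lookup-lookup∣≤cheb (x ∷ σ) (y ∷ π) Fin.zero    = m≤m⊔n _ _
∣lookup-lookup∣≤cheb (x ∷ σ) (y ∷ π) (Fin.suc j) =
  ≤-trans (∣lookup-lookup∣≤cheb σ π j) (m≤n⊔m _ _)

cheb<-pointwise : 0 < d → (σ π : Seq N m) →
  (∀ j → ∣ toℕ (lookup σ j) - toℕ (lookup π j) ∣ < d) → cheb σ π < d
cheb<-pointwise 0<d Vec.[] Vec.[] _ = 0<d
cheb<-pointwise 0<d (x ∷ σ) (y ∷ π) close =
  ⊔-lub (close Fin.zero) (cheb<-pointwise 0<d σ π (close ∘ Fin.suc))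

separated⇒Unique : 0 < d → {A : List (Seq N m)} →
  AllPairs (λ σ π → d ≤ cheb σ π) A → Unique A
separated⇒Unique 0<d = AllPairs.map λ { {σ} d≤ refl → <⇒≱ (cheb-self σ) d≤ }
  where
  cheb-self : ∀ σ → cheb σ σ < _
  cheb-self σ = cheb<-pointwise 0<d σ σ λ j →
    subst (_< _) (sym (∣n-n∣≡0 (toℕ (lookup σ j)))) 0<d

AllPairs-lookup : ∀ {a r} {A : Set a} {R : A → A → Set r} {xs : List A} →
  AllPairs R xs → ∀ {i j} → i Fin.< j → R (List.lookup xs i) (List.lookup xs j)
AllPairs-lookup (px ∷ _)  {Fin.zero}  {Fin.suc j} _         = All.lookup px (∈-lookup j)
AllPairs-lookup (_ ∷ pxs) {Fin.suc i} {Fin.suc j} (s<s i<j) = AllPairs-lookup pxs i<j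

length≤-if-AllPairs-≢-on : ∀ {a k} {A : Set a} (f : A → Fin k) {xs : List A} →
  AllPairs (λ x y → f x ≢ f y) xs → length xs ≤ k
length≤-if-AllPairs-≢-on {k = k} f {xs} fs≢ with length xs ≤? k
... | yes ≤k = ≤k
... | no ≰k with pigeonhole (≰⇒> ≰k) (f ∘ List.lookup xs)
...   | _ , _ , i<j , fᵢ≡fⱼ = contradiction fᵢ≡fⱼ (AllPairs-lookup fs≢ i<j)

funToFin-cong : {f g : Fin m → Fin q} → (∀ j → f j ≡ g j) → funToFin f ≡ funToFin g
funToFin-cong {m = zero}  _   = refl
funToFin-cong {m = suc _} f≗g =
  cong₂ combine (f≗g Fin.zero) (funToFin-cong (f≗g ∘ Fin.suc))

finToFun-distinguishes : {k l : Fin (q ^ m)} → k ≢ l →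
  ∃ λ j → finToFun k j ≢ finToFun l j
finToFun-distinguishes {q = q} {m} {k} {l} k≢l =
  ¬∀⟶∃¬ m _ (λ j → finToFun k j ≟ finToFun l j) λ k≗l → k≢l (begin
    k                                ≡⟨ funToFin-finToFin {m} {q} k ⟨
    funToFin {m} {q} (finToFun k)    ≡⟨ funToFin-cong k≗l ⟩
    funToFin {m} {q} (finToFun l)    ≡⟨ funToFin-finToFin {m} {q} l ⟩
    l                                ∎)
  where open ≡-Reasoning

[m/n]≡[o/n]⇒∣m-o∣<n : ∀ a b n .{{_ : NonZero n}} → a / n ≡ b / n → ∣ a - b ∣ < n
[m/n]≡[o/n]⇒∣m-o∣<n a b n a/n≡b/n = begin-strict
  ∣ a - b ∣
    ≡⟨ cong₂ ∣_-_∣ (trans (m≡m%n+[m/n]*n a n) (+-comm (a % n) _))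
                   (trans (m≡m%n+[m/n]*n b n) (+-comm (b % n) _)) ⟩
  ∣ a / n * n + a % n - b / n * n + b % n ∣
    ≡⟨ cong (λ c → ∣ a / n * n + a % n - c * n + b % n ∣) a/n≡b/n ⟨
  ∣ a / n * n + a % n - a / n * n + b % n ∣ ≡⟨ ∣m+n-m+o∣≡∣n-o∣ (a / n * n) _ _ ⟩
  ∣ a % n - b % n ∣                        ≤⟨ ∣m-n∣≤m⊔n (a % n) (b % n) ⟩
  a % n ⊔ b % n                           <⟨ ⊔-lub (m%n<n a n) (m%n<n b n) ⟩
  n                                       ∎
  where open ≤-Reasoning

module UpperBound .{{_ : NonZero d}} (N≤q*d : N ≤ q * d) where

  block : Fin N → Fin q
  block x = fromℕ< (m<n*o⇒m/o<n (<-≤-trans (toℕ<n x) N≤q*d))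

  signature : Seq N m → Fin (q ^ m)
  signature σ = funToFin (block ∘ lookup σ)

  signature≡⇒cheb< : (σ π : Seq N m) → signature σ ≡ signature π → cheb σ π < d
  signature≡⇒cheb< σ π sig≡ = cheb<-pointwise (>-nonZero⁻¹ _) σ π λ j →
    [m/n]≡[o/n]⇒∣m-o∣<n _ _ _ (begin
      toℕ (lookup σ j) / _            ≡⟨ toℕ-fromℕ< _ ⟨
      toℕ (block (lookup σ j))        ≡⟨ cong toℕ (finToFun-funToFin _ j) ⟨
      toℕ (finToFun (signature σ) j)  ≡⟨ cong (λ k → toℕ (finToFun k j)) sig≡ ⟩
      toℕ (finToFun (signature π) j)  ≡⟨ cong toℕ (finToFun-funToFin _ j) ⟩
      toℕ (block (lookup π j))        ≡⟨ toℕ-fromℕ< _ ⟩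
      toℕ (lookup π j) / _            ∎)
    where open ≡-Reasoning

  separated-length≤ : {A : List (Seq N m)} →
    AllPairs (λ σ π → d ≤ cheb σ π) A → length A ≤ q ^ m
  separated-length≤ separated = length≤-if-AllPairs-≢-on signature
    (AllPairs.map (λ {σ} {π} d≤ sig≡ → <⇒≱ (signature≡⇒cheb< σ π sig≡) d≤)
                  separated)

module LowerBound .{{_ : NonZero d}} (m≤d : m ≤ d) (fits : q * d + m ≤ N + d) where

  symbol<N : (j : Fin m) (a : Fin q) → toℕ j + toℕ a * d < N
  symbol<N j a = +-cancelʳ-≤ d _ _ (begin
    suc (toℕ j + toℕ a * d) + d     ≡⟨ +-assoc (suc (toℕ j)) _ d ⟩
    suc (toℕ j) + (toℕ a * d + d)   ≡⟨ cong (suc (toℕ j) +_) (+-comm _ d) ⟩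
    suc (toℕ j) + suc (toℕ a) * d   ≤⟨ +-mono-≤ (toℕ<n j) (*-monoˡ-≤ d (toℕ<n a)) ⟩
    m + q * d                       ≡⟨ +-comm m _ ⟩
    q * d + m                       ≤⟨ fits ⟩
    N + d                           ∎)
    where open ≤-Reasoning

  codeword : (Fin m → Fin q) → Seq N m
  codeword f = tabulate λ j → fromℕ< (symbol<N j (f j))

  toℕ-codeword : ∀ f j → toℕ (lookup (codeword f) j) ≡ toℕ j + toℕ (f j) * d
  toℕ-codeword f j = trans (cong toℕ (lookup∘tabulate _ j)) (toℕ-fromℕ< _)

  codeword-distinct : ∀ f → DistinctSymbols (codeword f)
  codeword-distinct f {j} {k} fⱼ≡fₖ = toℕ-injective (begin
    toℕ j                                    ≡⟨ position j ⟨
    (toℕ j + toℕ (f j) * d) % d              ≡⟨ cong (_% d) (toℕ-codeword f j) ⟨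
    toℕ (lookup (codeword f) j) % d          ≡⟨ cong (λ x → toℕ x % d) fⱼ≡fₖ ⟩
    toℕ (lookup (codeword f) k) % d          ≡⟨ cong (_% d) (toℕ-codeword f k) ⟩
    (toℕ k + toℕ (f k) * d) % d              ≡⟨ position k ⟩
    toℕ k                                    ∎)
    where
    open ≡-Reasoning
    position : ∀ i → (toℕ i + toℕ (f i) * d) % d ≡ toℕ i
    position i = trans ([m+kn]%n≡m%n (toℕ i) (toℕ (f i)) d)
                       (m<n⇒m%n≡m (<-≤-trans (toℕ<n i) m≤d))

  codeword-far : ∀ f g j → f j ≢ g j → d ≤ cheb (codeword f) (codeword g)
  codeword-far f g j fⱼ≢gⱼ = begin
    d                                  ≡⟨ *-identityˡ d ⟨
    1 * d                              ≤⟨ *-monoˡ-≤ d 1≤∣a-b∣ ⟩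
    ∣ a - b ∣ * d                      ≡⟨ *-distribʳ-∣-∣ d a b ⟩
    ∣ a * d - b * d ∣                  ≡⟨ ∣m+n-m+o∣≡∣n-o∣ (toℕ j) _ _ ⟨
    ∣ toℕ j + a * d - toℕ j + b * d ∣
      ≡⟨ cong₂ ∣_-_∣ (toℕ-codeword f j) (toℕ-codeword g j) ⟨
    ∣ toℕ (lookup (codeword f) j) - toℕ (lookup (codeword g) j) ∣
      ≤⟨ ∣lookup-lookup∣≤cheb (codeword f) (codeword g) j ⟩
    cheb (codeword f) (codeword g)     ∎
    where
    open ≤-Reasoning
    a = toℕ (f j)
    b = toℕ (g j)
    1≤∣a-b∣ : 1 ≤ ∣ a - b ∣
    1≤∣a-b∣ = n≢0⇒n>0 (fⱼ≢gⱼ ∘ toℕ-injective ∘ ∣m-n∣≡0⇒m≡n)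

  blockCode : List (Seq N m)
  blockCode = List.tabulate (codeword ∘ finToFun)

  blockCode-separated : AllPairs (λ σ π → d ≤ cheb σ π) blockCode
  blockCode-separated = AllPairs.tabulate⁺ λ {k} {l} k≢l →
    let j , ne = finToFun-distinguishes k≢l in codeword-far (finToFun k) (finToFun l) j ne

  blockCode-isCode : IsCode N m d blockCode
  blockCode-isCode = separated⇒Unique (>-nonZero⁻¹ d) blockCode-separated
                   , All.tabulate⁺ (codeword-distinct ∘ finToFun)
                   , blockCode-separated

blockCode-isP : .{{_ : NonZero d}} → m ≤ d → N ≤ q * d → q * d + m ≤ N + d →
  IsP N m d (q ^ m)
blockCode-isP {q = q} m≤d N≤q*d fits =
  (blockCode , blockCode-isCode , length-tabulate _) ,
  λ _ (_ , _ , separated) → separated-length≤ separated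
  where
  open LowerBound {q = q} m≤d fits
  open UpperBound {q = q} N≤q*d

theorem20 : (n m d : ℕ) → .{{_ : NonZero n}} → .{{_ : NonZero d}} →
    d ∣ n → m ≤ d → 2 ≤ m → (i : ℕ) → i ≤ d ∸ m → m < n ∸ i →
    IsP (n ∸ i) m d ((n / d) ^ m)
theorem20 n m d d∣n m≤d _ i i≤d∸m _ =
  blockCode-isP m≤d (≤-trans (m∸n≤m n i) (≤-reflexive (sym q*d≡n))) fits
  where
  q*d≡n : n / d * d ≡ n
  q*d≡n = m/n*n≡m d∣n
  i+m≤d : i + m ≤ d
  i+m≤d = m≤o∸n⇒m+n≤o i m≤d i≤d∸m
  i≤n : i ≤ n
  i≤n = ≤-trans (m≤m+n i m) (≤-trans i+m≤d (∣⇒≤ d∣n))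
  fits : n / d * d + m ≤ n ∸ i + d
  fits = begin
    n / d * d + m     ≡⟨ cong (_+ m) q*d≡n ⟩
    n + m             ≡⟨ cong (_+ m) (m∸n+n≡m i≤n) ⟨
    n ∸ i + i + m     ≡⟨ +-assoc (n ∸ i) i m ⟩
    n ∸ i + (i + m)   ≤⟨ +-monoʳ-≤ (n ∸ i) i+m≤d ⟩
    n ∸ i + d         ∎
    where open ≤-Reasoning
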